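{- Let $\mathbf z$ be the infinite fixed point, starting with $a$, of the morphism $h$ with $h(a)=aab$, $h(b)=b$. Define $f:\mathbb N\to\mathbb N$ by $f(i)=j$ whenever $2^{j+1}+j-2\le i\le 2^{j+2}+j-2$. Then for every $n\ge 0$: (a) every factor of $\mathbf z$ of length $n$ contains a $b$-run of length at least $f(n)$; (b) at least one factor of $\mathbf z$ of length $n$ has longest $b$-run of length exactly $f(n)$; (c) the shortest factor of $\mathbf z$ having two occurrences of a $b$-run of length $n$ has length $2^{n+1}+n-1$.
   Context: A factor of an infinite word is a finite contiguous block of it. A $b$-run of a word $w$ is a maximal occurrence of a block of consecutive $b$'s in $w$ (not extendable within $w$ by a $b$ on either side); its length is its number of $b$'s. -}

module Defs where

open import Data.Nat using (ℕ; zero; suc; _+_; _∸_; _^_; _≤_; _<_)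
open import Data.List using (List; []; _∷_; _++_; concatMap; length; applyUpTo)
open import Data.Maybe using (Maybe; just; nothing; fromMaybe)
open import Data.Product using (Σ; ∃; _×_; _,_)
open import Data.Sum using (_⊎_)
open import Relation.Binary.PropositionalEquality using (_≡_; _≢_)

data Letter : Set where
  a b : Letter

h : Letter → List Letter
h a = a ∷ a ∷ b ∷ []
h b = b ∷ []

hWord : List Letter → List Letter
hWord = concatMap h

hIter : ℕ → List Letter
hIter zero    = a ∷ []
hIter (suc k) = hWord (hIter k)

at : List Letter → ℕ → Maybe Letter
at []       _       = nothing
at (x ∷ _)  zero    = just x
at (_ ∷ xs) (suc k) = at xs k

-- The infinite fixed point z = h^ω(a), as a function ℕ → Letter:
-- h^k(a) is a prefix of h^(k+1)(a) and has length 2^(k+1) - 1 > k,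
-- so the i-th letter of z is the i-th letter of h^(i+1)(a).
z : ℕ → Letter
z i = fromMaybe a (at (hIter (suc i)) i)

factorAt : ℕ → ℕ → List Letter
factorAt i n = applyUpTo (λ k → z (i + k)) n

IsFactor : List Letter → Set
IsFactor w = ∃ λ i → w ≡ factorAt i (length w)

-- BRun w p m : w has a b-run of length m starting at position p, i.e. a
-- maximal (within w) nonempty block w[p..p+m) of consecutive b's.
BRun : List Letter → ℕ → ℕ → Set
BRun w p m =
  1 ≤ m × p + m ≤ length w
  × (∀ k → k < m → at w (p + k) ≡ just b)
  × (∀ q → suc q ≡ p → at w q ≢ just b)
  × at w (p + m) ≢ just b

-- The longest b-run of w has length m (convention: m = 0 when w has no b-run).
LongestBRun : List Letter → ℕ → Set
LongestBRun w m =
  (∀ p m′ → BRun w p m′ → m′ ≤ m)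
  × (m ≡ 0 ⊎ ∃ λ p → BRun w p m)

TwoBRuns : List Letter → ℕ → Set
TwoBRuns w n = ∃ λ p → ∃ λ q → p < q × BRun w p n × BRun w q n

-- The graph of f : f(i) = j iff 2^(j+1)+j-2 ≤ i ≤ 2^(j+2)+j-2.
FRel : ℕ → ℕ → Set
FRel i j = 2 ^ (j + 1) + j ∸ 2 ≤ i × i ≤ 2 ^ (j + 2) + j ∸ 2

-- Write ℓ k = 2^(k+1) - 1 = |h^k(a)|.  Since h^(k+1)(a) = h^k(a) h^k(a) b, the word z is
-- self-similar: z(ℓ k + s) = z(s) for s < ℓ k, z(ℓ k) = a and z(2 ℓ k) = b, and the rest
-- of the argument uses only these three facts.  By induction on k, h^k(a) h^k(a) contains no
-- block b^(k+1), while h^k(a) ends with b^k.  Locating a window relative to the midpoint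
-- ℓ k of h^(k+1)(a) then gives, again by induction, that every window of length
-- ℓ m + m - 1 contains b^m (part (a)), and that two blocks b^m, the first of them followed
-- by a, start at least ℓ m apart (part (c)).  The witnesses of (b) and (c) are read off the
-- occurrences of b^m at the end of h^m(a) and of h^(m+1)(a) = h^m(a) h^m(a) b.
module Submission where

open import Defs
open import Data.Nat using (ℕ; zero; suc; _+_; _∸_; _^_; _*_; _≤_; _<_; s≤s; z<s;
  _≤?_; _≟_; _≤′_; ≤′-refl; ≤′-step)
open import Data.Nat.Properties
open import Data.Nat.Tactic.RingSolver using (solve-∀)
open import Data.List using (List; []; _∷_; _++_; [_]; length; applyUpTo)
open import Data.List.Properties using (length-++; length-applyUpTo; concatMap-++)
open import Data.Maybe using (Maybe; just; nothing; fromMaybe)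
open import Data.Maybe.Properties using (just-injective)
open import Data.Product using (∃; _×_; _,_)
open import Data.Sum using (_⊎_; inj₁; inj₂)
open import Data.Empty using (⊥; ⊥-elim)
open import Relation.Nullary using (¬_; Dec; yes; no)
open import Relation.Binary.Definitions using (tri<; tri≈; tri>)
open import Relation.Binary.PropositionalEquality hiding ([_])

ℓ : ℕ → ℕ
ℓ zero    = 1
ℓ (suc k) = suc (ℓ k + ℓ k)

ℓ-pos : ∀ k → 0 < ℓ k
ℓ-pos zero    = z<s
ℓ-pos (suc k) = z<s

ℓ<ℓ-suc : ∀ k → ℓ k < ℓ (suc k)
ℓ<ℓ-suc k = s≤s (m≤m+n (ℓ k) (ℓ k))

n<ℓn : ∀ n → n < ℓ n
n<ℓn zero    = z<s
n<ℓn (suc n) = s≤s (≤-trans (n<ℓn n) (m≤m+n (ℓ n) (ℓ n)))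

ℓ-mono-≤ : ∀ {j k} → j ≤ k → ℓ j ≤ ℓ k
ℓ-mono-≤ j≤k = go (≤⇒≤′ j≤k)
  where
  go : ∀ {j k} → j ≤′ k → ℓ j ≤ ℓ k
  go ≤′-refl        = ≤-refl
  go (≤′-step j≤′k) = ≤-trans (go j≤′k) (<⇒≤ (ℓ<ℓ-suc _))

ℓ-cancel-< : ∀ {j k} → ℓ j < ℓ k → j < k
ℓ-cancel-< ℓj<ℓk = ≰⇒> (λ k≤j → <⇒≱ ℓj<ℓk (ℓ-mono-≤ k≤j))

ℓ-cancel-≤ : ∀ {j k} → ℓ j ≤ ℓ k → j ≤ k
ℓ-cancel-≤ {k = k} ℓj≤ℓk = ≤-pred (ℓ-cancel-< (≤-<-trans ℓj≤ℓk (ℓ<ℓ-suc k)))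

2^[k+1]≡1+ℓk : ∀ k → 2 ^ (k + 1) ≡ suc (ℓ k)
2^[k+1]≡1+ℓk zero    = refl
2^[k+1]≡1+ℓk (suc k) = trans (cong (2 *_) (2^[k+1]≡1+ℓk k)) (double (ℓ k))
  where
  double : ∀ x → 2 * suc x ≡ suc (suc (x + x))
  double = solve-∀

-- Words and the prefixes h^k(a)

hIter-suc : ∀ k → hIter (suc k) ≡ hIter k ++ hIter k ++ [ b ]
hIter-suc zero    = refl
hIter-suc (suc k) = begin
  hWord (hIter (suc k))                     ≡⟨ cong hWord (hIter-suc k) ⟩
  hWord (hIter k ++ hIter k ++ [ b ])       ≡⟨ concatMap-++ h (hIter k) _ ⟩
  hIter (suc k) ++ hWord (hIter k ++ [ b ]) ≡⟨ cong (hIter (suc k) ++_) (concatMap-++ h (hIter k) _) ⟩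
  hIter (suc k) ++ hIter (suc k) ++ [ b ]   ∎
  where open ≡-Reasoning

length-hIter : ∀ k → length (hIter k) ≡ ℓ k
length-hIter zero    = refl
length-hIter (suc k) = begin
  length (hIter (suc k))                        ≡⟨ cong length (hIter-suc k) ⟩
  length (hIter k ++ hIter k ++ [ b ])          ≡⟨ length-++ (hIter k) ⟩
  length (hIter k) + length (hIter k ++ [ b ])  ≡⟨ cong (length (hIter k) +_) (length-++ (hIter k)) ⟩
  length (hIter k) + (length (hIter k) + 1)     ≡⟨ cong (λ x → x + (x + 1)) (length-hIter k) ⟩
  ℓ k + (ℓ k + 1)                               ≡⟨ cong (ℓ k +_) (+-comm (ℓ k) 1) ⟩
  ℓ k + suc (ℓ k)                               ≡⟨ +-suc (ℓ k) (ℓ k) ⟩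
  suc (ℓ k + ℓ k)                               ∎
  where open ≡-Reasoning

at-++ˡ : ∀ xs {ys : List Letter} {n i} → length xs ≡ n → i < n → at (xs ++ ys) i ≡ at xs i
at-++ˡ []       refl ()
at-++ˡ (x ∷ xs) {i = zero}  refl _         = refl
at-++ˡ (x ∷ xs) {i = suc i} refl (s≤s i<n) = at-++ˡ xs refl i<n

at-++ʳ : ∀ xs {ys : List Letter} {n} j → length xs ≡ n → at (xs ++ ys) (n + j) ≡ at ys j
at-++ʳ []       j refl = refl
at-++ʳ (x ∷ xs) j refl = at-++ʳ xs j refl

at-beyond : ∀ w {k} → length w ≤ k → at w k ≢ just b
at-beyond []      _                   ()
at-beyond (x ∷ w) {suc k} (s≤s w≤k) = at-beyond w w≤k

at-applyUpTo : ∀ (f : ℕ → Letter) n {k} → k < n → at (applyUpTo f n) k ≡ just (f k)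
at-applyUpTo f (suc n) {zero}  _         = refl
at-applyUpTo f (suc n) {suc k} (s≤s k<n) = at-applyUpTo (λ i → f (suc i)) n k<n

at-hIter-first : ∀ K {i} → i < ℓ K → at (hIter (suc K)) i ≡ at (hIter K) i
at-hIter-first K i<ℓK rewrite hIter-suc K = at-++ˡ (hIter K) (length-hIter K) i<ℓK

at-hIter-second : ∀ K {s} → s < ℓ K → at (hIter (suc K)) (ℓ K + s) ≡ at (hIter K) s
at-hIter-second K {s} s<ℓK rewrite hIter-suc K =
  trans (at-++ʳ (hIter K) s (length-hIter K)) (at-++ˡ (hIter K) (length-hIter K) s<ℓK)

at-hIter-last : ∀ K → at (hIter (suc K)) (ℓ K + ℓ K) ≡ just b
at-hIter-last K rewrite hIter-suc K =
  trans (at-++ʳ (hIter K) (ℓ K) (length-hIter K))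
        (trans (cong (at (hIter K ++ [ b ])) (sym (+-identityʳ (ℓ K))))
               (at-++ʳ (hIter K) 0 (length-hIter K)))

hIter-stable : ∀ {K K′ i} → K ≤′ K′ → i < ℓ K → at (hIter K′) i ≡ at (hIter K) i
hIter-stable ≤′-refl        _    = refl
hIter-stable (≤′-step K≤′K′) i<ℓK =
  trans (at-hIter-first _ (<-≤-trans i<ℓK (ℓ-mono-≤ (≤′⇒≤ K≤′K′)))) (hIter-stable K≤′K′ i<ℓK)

z-hIter : ∀ K {i} → i < ℓ K → z i ≡ fromMaybe a (at (hIter K) i)
z-hIter K {i} i<ℓK with ≤-total K (suc i)
... | inj₁ K≤ = cong (fromMaybe a) (hIter-stable (≤⇒≤′ K≤) i<ℓK)
... | inj₂ ≤K = sym (cong (fromMaybe a) (hIter-stable (≤⇒≤′ ≤K) (<-trans (n<ℓn i) (ℓ<ℓ-suc i))))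

z-self-similar : ∀ K {s} → s < ℓ K → z (ℓ K + s) ≡ z s
z-self-similar K {s} s<ℓK = begin
  z (ℓ K + s)                                 ≡⟨ z-hIter (suc K) (s≤s (+-monoʳ-≤ (ℓ K) (<⇒≤ s<ℓK))) ⟩
  fromMaybe a (at (hIter (suc K)) (ℓ K + s)) ≡⟨ cong (fromMaybe a) (at-hIter-second K s<ℓK) ⟩
  fromMaybe a (at (hIter K) s)               ≡⟨ sym (z-hIter K s<ℓK) ⟩
  z s                                         ∎
  where open ≡-Reasoning

z-ℓ+ℓ : ∀ K → z (ℓ K + ℓ K) ≡ b
z-ℓ+ℓ K = trans (z-hIter (suc K) ≤-refl) (cong (fromMaybe a) (at-hIter-last K))

z-ℓ : ∀ K → z (ℓ K) ≡ a
z-ℓ K = trans (cong z (sym (+-identityʳ (ℓ K)))) (z-self-similar K (ℓ-pos K))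

a≢b : a ≢ b
a≢b ()

≢b⇒≡a : ∀ {c} → c ≢ b → c ≡ a
≢b⇒≡a {a} _   = refl
≢b⇒≡a {b} c≢b = ⊥-elim (c≢b refl)

-- Blocks of b's in z

BBlock : ℕ → ℕ → Set
BBlock X n = ∀ t → t < n → z (X + t) ≡ b

BBlock-≤ : ∀ {X m n} → m ≤ n → BBlock X n → BBlock X m
BBlock-≤ m≤n bb t t<m = bb t (<-≤-trans t<m m≤n)

BBlock-∌a : ∀ {X n P} → BBlock X n → z P ≡ a → X ≤ P → P < X + n → ⊥
BBlock-∌a {X} bb zP≡a X≤P P<X+n with m≤n⇒∃[o]m+o≡n X≤P
... | t , refl = a≢b (trans (sym zP≡a) (bb t (+-cancelˡ-< X _ _ P<X+n)))

BBlock-after-a : ∀ {X Y m} → BBlock Y m → z (X + m) ≡ a → X < Y → X + m < Y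
BBlock-after-a {X} {Y} {m} bbY zXa X<Y = ≰⇒> λ Y≤X+m →
  BBlock-∌a bbY zXa Y≤X+m (+-monoˡ-< m X<Y)

BBlock-shift : ∀ K {X n} → X + n ≤ ℓ K → BBlock X n → BBlock (ℓ K + X) n
BBlock-shift K {X} fits bb t t<n =
  trans (cong z (+-assoc (ℓ K) X t))
        (trans (z-self-similar K (<-≤-trans (+-monoʳ-< X t<n) fits)) (bb t t<n))

BBlock-unshift : ∀ K {X n} → X + n ≤ ℓ K → BBlock (ℓ K + X) n → BBlock X n
BBlock-unshift K {X} fits bb t t<n =
  trans (sym (z-self-similar K (<-≤-trans (+-monoʳ-< X t<n) fits)))
        (trans (cong z (sym (+-assoc (ℓ K) X t))) (bb t t<n))

+-split : ∀ {X c M N} → X + c ≡ M + N → c ≤ N → ∃ λ X′ → X ≡ M + X′ × X′ + c ≡ N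
+-split {X} {c} {M} {N} eq c≤N
  with m≤n⇒∃[o]m+o≡n (+-cancelʳ-≤ c M X (≤-trans (+-monoʳ-≤ M c≤N) (≤-reflexive (sym eq))))
... | X′ , refl = X′ , refl , +-cancelˡ-≡ M _ _ (trans (sym (+-assoc M X′ c)) eq)

z-suffix : ∀ K {t X} → t < K → X + suc t ≡ ℓ K → z X ≡ b
z-suffix (suc K) {zero} {X} _ eq =
  trans (cong z (suc-injective (trans (+-comm 1 X) eq))) (z-ℓ+ℓ K)
z-suffix (suc K) {suc t} {X} (s≤s t<K) eq
  with +-split {X} {M = ℓ K} (suc-injective (trans (sym (+-suc X (suc t))) eq)) (≤-trans t<K (<⇒≤ (n<ℓn K)))
... | X′ , refl , X′+t≡ℓK =
  trans (z-self-similar K (subst (X′ <_) X′+t≡ℓK (m<m+n X′ z<s))) (z-suffix K t<K X′+t≡ℓK)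

BBlock-suffix : ∀ K {X m} → m ≤ K → X + m ≡ ℓ K → BBlock X m
BBlock-suffix K {X} m≤K eq t t<m with m≤n⇒∃[o]m+o≡n t<m
... | u , refl = z-suffix K (<-≤-trans (m<n+m u z<s) m≤K) (trans (shuffle X t u) eq)
  where
  shuffle : ∀ X t u → X + t + suc u ≡ X + (suc t + u)
  shuffle = solve-∀

data Window (K : ℕ) : ℕ → ℕ → Set where
  inFirst  : ∀ {X n} → X + n ≤ ℓ K → Window K X n
  inSecond : ∀ {X n} → X + n ≤ ℓ K → Window K (ℓ K + X) n
  acrossℓ  : ∀ {X n} → X < ℓ K → ℓ K < X + n → Window K X n

window : ∀ K X n → X + n ≤ ℓ K + ℓ K → Window K X n
window K X n fits with X + n ≤? ℓ K | ℓ K ≤? X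
... | yes first | _        = inFirst first
... | no ¬first | no X<ℓK  = acrossℓ (≰⇒> X<ℓK) (≰⇒> ¬first)
... | no _      | yes ℓK≤X with m≤n⇒∃[o]m+o≡n ℓK≤X
... | X′ , refl = inSecond (+-cancelˡ-≤ (ℓ K) _ _ (subst (_≤ ℓ K + ℓ K) (+-assoc (ℓ K) X′ n) fits))

+suc≤suc⇒+≤ : ∀ x {n m} → x + suc n ≤ suc m → x + n ≤ m
+suc≤suc⇒+≤ x {n} {m} le = ≤-pred (subst (_≤ suc m) (+-suc x n) le)

no-long-BBlock : ∀ k {t} → t + suc k ≤ ℓ k + ℓ k → ¬ BBlock t (suc k)
no-long-BBlock zero {zero}        _              bb = a≢b (bb 0 z<s)
no-long-BBlock zero {suc zero}    _              bb = a≢b (bb 0 z<s)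
no-long-BBlock zero {suc (suc t)} (s≤s (s≤s le)) _  = n≮0 (≤-trans (m≤n+m 1 t) le)
no-long-BBlock (suc k) {t} fits bb with window (suc k) t (suc (suc k)) fits
... | inFirst {X} first = no-long-BBlock k (+suc≤suc⇒+≤ X first) (BBlock-≤ {X} (n≤1+n _) bb)
... | inSecond {X} second =
  no-long-BBlock k (+suc≤suc⇒+≤ X second) (BBlock-≤ {X} (n≤1+n _) (BBlock-unshift (suc k) {X} second bb))
... | acrossℓ X<ℓ ℓ<end = BBlock-∌a bb (z-ℓ (suc k)) (<⇒≤ X<ℓ) ℓ<end

BBlock-length-bound : ∀ K {X n} → BBlock X n → X + n ≤ ℓ K + ℓ K → n ≤ K
BBlock-length-bound K {X} {n} bb fits = ≮⇒≥ λ K<n →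
  no-long-BBlock K (≤-trans (+-monoʳ-≤ X K<n) fits) (BBlock-≤ {X} K<n bb)

ℓ≤BBlock-end : ∀ n {Y} → BBlock Y (suc n) → ℓ (suc n) ≤ Y + suc n
ℓ≤BBlock-end n bb = ≮⇒≥ λ end<ℓ → no-long-BBlock n (≤-pred end<ℓ) bb

z-before-suffix : ∀ m {X} → X + suc m ≡ ℓ m → z X ≡ a
z-before-suffix m {X} eq with z X in zX
... | a = refl
... | b = ⊥-elim (1+n≰n (BBlock-length-bound m bb (≤-trans (≤-reflexive eq) (m≤m+n (ℓ m) (ℓ m)))))
  where
  bb : BBlock X (suc m)
  bb zero    _         = trans (cong z (+-identityʳ X)) zX
  bb (suc t) (s≤s t<m) =
    trans (cong z (+-suc X t)) (BBlock-suffix m ≤-refl (trans (sym (+-suc X m)) eq) t t<m)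

+-offset-≤ : ∀ i {d n W} → d + n ≤ W → i + d + n ≤ i + W
+-offset-≤ i {d} {n} {W} le = subst (_≤ i + W) (sym (+-assoc i d n)) (+-monoʳ-≤ i le)

ℓ≤window-end : ∀ j i → ℓ (suc j) ≤ i + (ℓ (suc j) + j)
ℓ≤window-end j i = ≤-trans (m≤m+n _ j) (m≤n+m _ i)

BBlock-across-midpoint : ∀ j K i → suc j ≤ K → i < ℓ K → ℓ K < i + (ℓ (suc j) + j) →
                         ∃ λ d → d + suc j ≤ ℓ (suc j) + j × BBlock (i + d) (suc j)
BBlock-across-midpoint j K i j<K i<ℓK ℓK<end with i + suc j ≤? ℓ K
... | yes early with m≤n⇒∃[o]m+o≡n early
...   | o , i+m+o≡ℓK = o , o+m≤W , BBlock-suffix K j<K i+o+m≡ℓK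
  where
  swap : ∀ i o m → i + o + m ≡ i + m + o
  swap = solve-∀
  i+o+m≡ℓK : i + o + suc j ≡ ℓ K
  i+o+m≡ℓK = trans (swap i o (suc j)) i+m+o≡ℓK
  o+m≤W : o + suc j ≤ ℓ (suc j) + j
  o+m≤W = <⇒≤ (+-cancelˡ-< i _ _
            (subst (_< i + (ℓ (suc j) + j)) (sym (trans (sym (+-assoc i o (suc j))) i+o+m≡ℓK)) ℓK<end))
BBlock-across-midpoint j K i j<K i<ℓK ℓK<end | no late with m≤n⇒∃[o]m+o≡n (<⇒≤ i<ℓK)
... | e , i+e≡ℓK = e + s , d+m≤W , subst (λ x → BBlock x (suc j)) ℓK+s≡i+d
                     (BBlock-shift K {s} (≤-trans (≤-reflexive s+m≡ℓm) (ℓ-mono-≤ j<K))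
                       (BBlock-suffix (suc j) ≤-refl s+m≡ℓm))
  where
  s = ℓ (suc j) ∸ suc j
  s+m≡ℓm : s + suc j ≡ ℓ (suc j)
  s+m≡ℓm = m∸n+n≡m (<⇒≤ (n<ℓn (suc j)))
  ℓK+s≡i+d : ℓ K + s ≡ i + (e + s)
  ℓK+s≡i+d = trans (cong (_+ s) (sym i+e≡ℓK)) (+-assoc i e s)
  e≤j : e ≤ j
  e≤j = ≤-pred (+-cancelˡ-< i e (suc j) (subst (_< i + suc j) (sym i+e≡ℓK) (≰⇒> late)))
  d+m≤W : e + s + suc j ≤ ℓ (suc j) + j
  d+m≤W = begin
    e + s + suc j   ≡⟨ +-assoc e s (suc j) ⟩
    e + (s + suc j) ≡⟨ cong (e +_) s+m≡ℓm ⟩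
    e + ℓ (suc j)   ≡⟨ +-comm e (ℓ (suc j)) ⟩
    ℓ (suc j) + e   ≤⟨ +-monoʳ-≤ (ℓ (suc j)) e≤j ⟩
    ℓ (suc j) + j   ∎
    where open ≤-Reasoning

BBlock-in-window : ∀ j K i → i + (ℓ (suc j) + j) ≤ ℓ K →
                   ∃ λ d → d + suc j ≤ ℓ (suc j) + j × BBlock (i + d) (suc j)
BBlock-in-window j zero i fits =
  ⊥-elim (1+n≰n (≤-trans (≤-trans (s≤s (≤-trans (ℓ-pos j) (m≤m+n _ _))) (ℓ≤window-end j i)) fits))
BBlock-in-window j (suc K) i fits with i + (ℓ (suc j) + j) ≟ ℓ (suc K)
... | yes ends =
  ℓ j + ℓ j , ≤-reflexive (+-suc (ℓ j + ℓ j) j) ,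
  BBlock-suffix (suc K) (ℓ-cancel-≤ (≤-trans (ℓ≤window-end j i) (≤-reflexive ends)))
    (trans (align i (ℓ j + ℓ j) j) ends)
  where
  align : ∀ i x j → i + x + suc j ≡ i + (suc x + j)
  align = solve-∀
... | no ¬ends with window K i (ℓ (suc j) + j) (≤-pred (≤∧≢⇒< fits ¬ends))
...   | inFirst first = BBlock-in-window j K i first
...   | inSecond {i′} second with BBlock-in-window j K i′ second
...     | d , d+m≤W , bb =
  d , d+m≤W ,
  subst (λ x → BBlock x (suc j)) (sym (+-assoc (ℓ K) i′ d))
    (BBlock-shift K {i′ + d} (≤-trans (+-offset-≤ i′ d+m≤W) second) bb)
BBlock-in-window j (suc K) i fits | no ¬ends | acrossℓ i<ℓK ℓK<end =
  BBlock-across-midpoint j K i (≤-pred (ℓ-cancel-< (s≤s ℓ≤ℓK+ℓK))) i<ℓK ℓK<end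
  where
  ℓ≤ℓK+ℓK : ℓ (suc j) ≤ ℓ K + ℓ K
  ℓ≤ℓK+ℓK = ≤-trans (ℓ≤window-end j i) (≤-pred (≤∧≢⇒< fits ¬ends))

BBlock-gap-at-midpoint : ∀ n K {X Y} → X + suc n ≡ ℓ K → BBlock X (suc n) →
                         BBlock (ℓ K + Y) (suc n) → X + ℓ (suc n) ≤ ℓ K + Y
BBlock-gap-at-midpoint n K {X} {Y} ends bbX bbY = begin
  X + ℓ (suc n)   ≤⟨ +-monoʳ-≤ X ℓ≤Y+m ⟩
  X + (Y + suc n) ≡⟨ swap X Y (suc n) ⟩
  X + suc n + Y   ≡⟨ cong (_+ Y) ends ⟩
  ℓ K + Y         ∎
  where
  open ≤-Reasoning
  swap : ∀ x y m → x + (y + m) ≡ x + m + y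
  swap = solve-∀
  m≤K : suc n ≤ K
  m≤K = BBlock-length-bound K bbX (≤-trans (≤-reflexive ends) (m≤m+n (ℓ K) (ℓ K)))
  ℓ≤Y+m : ℓ (suc n) ≤ Y + suc n
  ℓ≤Y+m with Y + suc n ≤? ℓ K
  ... | yes fits = ℓ≤BBlock-end n (BBlock-unshift K {Y} fits bbY)
  ... | no late  = ≤-trans (ℓ-mono-≤ m≤K) (<⇒≤ (≰⇒> late))

BBlock-gap : ∀ n K {X Y} → Y + suc n ≤ ℓ K → BBlock X (suc n) → z (X + suc n) ≡ a →
             BBlock Y (suc n) → X < Y → X + ℓ (suc n) ≤ Y

-- The suffix b^m of h^K(a) serves as the second block, so the room left after a block
-- follows from the gap at the same level K.
BBlock-room : ∀ n K {X} → BBlock X (suc n) → z (X + suc n) ≡ a → X + suc n < ℓ K →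
              X + ℓ (suc n) + suc n ≤ ℓ K
BBlock-room n K {X} bbX zXa early = ≤-trans (+-monoˡ-≤ (suc n) gap) (≤-reflexive Y₀+m≡ℓK)
  where
  m≤K : suc n ≤ K
  m≤K = BBlock-length-bound K bbX (≤-trans (<⇒≤ early) (m≤m+n (ℓ K) (ℓ K)))
  Y₀ = ℓ K ∸ suc n
  Y₀+m≡ℓK : Y₀ + suc n ≡ ℓ K
  Y₀+m≡ℓK = m∸n+n≡m (≤-trans m≤K (<⇒≤ (n<ℓn K)))
  gap : X + ℓ (suc n) ≤ Y₀
  gap = BBlock-gap n K (≤-reflexive Y₀+m≡ℓK) bbX zXa (BBlock-suffix K m≤K Y₀+m≡ℓK)
          (+-cancelʳ-< (suc n) X Y₀ (subst (X + suc n <_) (sym Y₀+m≡ℓK) early))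

BBlock-gap n zero {X} {Y} fits _ _ _ X<Y = ⊥-elim (n≮0 (<-≤-trans X<Y Y≤0))
  where
  Y≤0 : Y ≤ 0
  Y≤0 = ≤-trans (m≤m+n Y n) (+suc≤suc⇒+≤ Y fits)
BBlock-gap n (suc K) {X} {Y} fits bbX zXa bbY X<Y with Y + suc n ≤? ℓ K
... | yes fitsK = BBlock-gap n K fitsK bbX zXa bbY X<Y
... | no lateY with <-cmp (X + suc n) (ℓ K)
...   | tri< early _ _ =
  <⇒≤ (+-cancelʳ-< (suc n) _ _ (≤-<-trans (BBlock-room n K bbX zXa early) (≰⇒> lateY)))
...   | tri≈ _ ends _ with m≤n⇒∃[o]m+o≡n (≤-trans (≤-reflexive (sym ends)) (<⇒≤ (BBlock-after-a bbY zXa X<Y)))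
...     | Y′ , refl = BBlock-gap-at-midpoint n K ends bbX bbY
BBlock-gap n (suc K) {X} {Y} fits bbX zXa bbY X<Y | no lateY | tri> _ _ lateX with ℓ K ≤? X
... | no X<ℓK = ⊥-elim (BBlock-∌a bbX (z-ℓ K) (<⇒≤ (≰⇒> X<ℓK)) lateX)
... | yes ℓK≤X with m≤n⇒∃[o]m+o≡n ℓK≤X | m≤n⇒∃[o]m+o≡n (≤-trans ℓK≤X (<⇒≤ X<Y))
...   | X′ , refl | Y′ , refl =
  subst (_≤ ℓ K + Y′) (sym (+-assoc (ℓ K) X′ (ℓ (suc n)))) (+-monoʳ-≤ (ℓ K) gap)
  where
  X′+m<Y′ : X′ + suc n < Y′
  X′+m<Y′ = +-cancelˡ-< (ℓ K) _ _
    (subst (_< ℓ K + Y′) (+-assoc (ℓ K) X′ (suc n)) (BBlock-after-a bbY zXa X<Y))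
  Y′≤ℓK : Y′ ≤ ℓ K
  Y′≤ℓK = ≤-trans (m≤m+n Y′ n) (+suc≤suc⇒+≤ Y′ (+-cancelˡ-≤ (ℓ K) _ _
    (subst₂ _≤_ (+-assoc (ℓ K) Y′ (suc n)) (sym (+-suc (ℓ K) (ℓ K))) fits)))
  X′+m<ℓK : X′ + suc n < ℓ K
  X′+m<ℓK = <-≤-trans X′+m<Y′ Y′≤ℓK
  zX′a : z (X′ + suc n) ≡ a
  zX′a = trans (sym (z-self-similar K X′+m<ℓK)) (trans (cong z (sym (+-assoc (ℓ K) X′ (suc n)))) zXa)
  bbX′ : BBlock X′ (suc n)
  bbX′ = BBlock-unshift K {X′} (<⇒≤ X′+m<ℓK) bbX
  gap : X′ + ℓ (suc n) ≤ Y′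
  gap with Y′ + suc n ≤? ℓ K
  ... | yes fitsK = BBlock-gap n K fitsK bbX′ zX′a (BBlock-unshift K {Y′} fitsK bbY)
                      (+-cancelˡ-< (ℓ K) X′ Y′ X<Y)
  ... | no lateY′ =
    <⇒≤ (+-cancelʳ-< (suc n) _ _ (≤-<-trans (BBlock-room n K bbX′ zX′a X′+m<ℓK) (≰⇒> lateY′)))

-- b-runs of finite words

BSegment : List Letter → ℕ → ℕ → Set
BSegment w x m = ∀ k → k < m → at w (x + k) ≡ just b

b? : (c : Maybe Letter) → Dec (c ≡ just b)
b? (just a) = no λ ()
b? (just b) = yes refl
b? nothing  = no λ ()

BSegment-snoc : ∀ {w x m} → BSegment w x m → at w (x + m) ≡ just b → BSegment w x (suc m)
BSegment-snoc seg isb k k<1+m with m≤n⇒m<n∨m≡n (≤-pred k<1+m)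
... | inj₁ k<m = seg k k<m
... | inj₂ refl = isb

BSegment-cons : ∀ {w x m} → BSegment w (suc x) m → at w x ≡ just b → BSegment w x (suc m)
BSegment-cons {w} {x} seg isb zero    _         = trans (cong (at w) (+-identityʳ x)) isb
BSegment-cons {w} {x} seg isb (suc k) (s≤s k<m) = trans (cong (at w) (+-suc x k)) (seg k k<m)

BSegment-extendʳ : ∀ f w {x m} → x + m + f ≡ length w → BSegment w x m →
  ∃ λ m′ → m ≤ m′ × x + m′ ≤ length w × BSegment w x m′ × at w (x + m′) ≢ just b
BSegment-extendʳ zero w {x} {m} eq seg =
  m , ≤-refl , ≤-reflexive end , seg , at-beyond w (≤-reflexive (sym end))
  where
  end : x + m ≡ length w
  end = trans (sym (+-identityʳ (x + m))) eq
BSegment-extendʳ (suc f) w {x} {m} eq seg with b? (at w (x + m))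
... | no ¬b = m , ≤-refl , ≤-trans (m≤m+n (x + m) (suc f)) (≤-reflexive eq) , seg , ¬b
... | yes isb with BSegment-extendʳ f w {x} {suc m}
                     (trans (cong (_+ f) (+-suc x m)) (trans (sym (+-suc (x + m) f)) eq))
                     (BSegment-snoc {w} seg isb)
...   | m′ , m<m′ , maximal = m′ , ≤-trans (n≤1+n m) m<m′ , maximal

BSegment-extendˡ : ∀ x w {m} → 1 ≤ m → x + m ≤ length w → BSegment w x m → at w (x + m) ≢ just b →
  ∃ λ p → ∃ λ m′ → BRun w p m′ × m ≤ m′
BSegment-extendˡ zero w 1≤m fits seg ¬b = 0 , _ , (1≤m , fits , seg , (λ _ ()) , ¬b) , ≤-refl
BSegment-extendˡ (suc x) w {m} 1≤m fits seg ¬b with b? (at w x)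
... | no ¬b′ = suc x , m , (1≤m , fits , seg , (λ { q refl → ¬b′ }) , ¬b) , ≤-refl
... | yes isb with BSegment-extendˡ x w {suc m} z<s (subst (_≤ length w) (sym (+-suc x m)) fits)
                     (BSegment-cons {w} seg isb) (λ isb′ → ¬b (trans (cong (at w) (sym (+-suc x m))) isb′))
...   | p , m′ , run , m<m′ = p , m′ , run , ≤-trans (n≤1+n m) m<m′

BSegment⇒BRun : ∀ w {x m} → 1 ≤ m → x + m ≤ length w → BSegment w x m →
                ∃ λ p → ∃ λ m′ → BRun w p m′ × m ≤ m′
BSegment⇒BRun w {x} 1≤m fits seg with m≤n⇒∃[o]m+o≡n fits
... | f , eq with BSegment-extendʳ f w eq seg
... | m′ , m≤m′ , fits′ , seg′ , ¬b with BSegment-extendˡ x w (≤-trans 1≤m m≤m′) fits′ seg′ ¬b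
... | p , m″ , run , m′≤m″ = p , m″ , run , ≤-trans m≤m′ m′≤m″

length-factorAt : ∀ i n → length (factorAt i n) ≡ n
length-factorAt i n = length-applyUpTo (λ k → z (i + k)) n

factorAt-self : ∀ i n → factorAt i n ≡ factorAt i (length (factorAt i n))
factorAt-self i n = cong (factorAt i) (sym (length-factorAt i n))

factorAt-IsFactor : ∀ i n → IsFactor (factorAt i n)
factorAt-IsFactor i n = i , factorAt-self i n

at-factor : ∀ {w} i → w ≡ factorAt i (length w) → ∀ {k} → k < length w → at w k ≡ just (z (i + k))
at-factor {w} i eq {k} k<|w| =
  trans (cong (λ v → at v k) eq) (at-applyUpTo (λ k → z (i + k)) (length w) k<|w|)

BBlock⇒BSegment : ∀ {w} i {d m} → w ≡ factorAt i (length w) → d + m ≤ length w →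
                  BBlock (i + d) m → BSegment w d m
BBlock⇒BSegment i {d} eq fits bb t t<m =
  trans (at-factor i eq (<-≤-trans (+-monoʳ-< d t<m) fits))
        (cong just (trans (cong z (sym (+-assoc i d t))) (bb t t<m)))

BRun⇒BBlock : ∀ {w} i {p m} → w ≡ factorAt i (length w) → BRun w p m → BBlock (i + p) m
BRun⇒BBlock i {p} eq (_ , fits , seg , _ , _) t t<m =
  trans (cong z (+-assoc i p t))
        (just-injective (trans (sym (at-factor i eq (<-≤-trans (+-monoʳ-< p t<m) fits))) (seg t t<m)))

BRun⇒a-after : ∀ {w} i {p m} → w ≡ factorAt i (length w) → BRun w p m → p + m < length w →
               z (i + p + m) ≡ a
BRun⇒a-after i {p} {m} eq (_ , _ , _ , _ , ¬b) end<|w| = ≢b⇒≡a λ zb →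
  ¬b (trans (at-factor i eq end<|w|) (cong just (trans (cong z (sym (+-assoc i p m))) zb)))

BBlock⇒BRun : ∀ i {n p m} → 1 ≤ m → p + m ≤ n → BBlock (i + p) m →
              (∀ q → suc q ≡ p → z (i + q) ≡ a) → (p + m < n → z (i + (p + m)) ≡ a) →
              BRun (factorAt i n) p m
BBlock⇒BRun i {n} {p} {m} 1≤m fits bb before after =
  1≤m , fits′ , BBlock⇒BSegment i (factorAt-self i n) fits′ bb , left , right
  where
  fits′ : p + m ≤ length (factorAt i n)
  fits′ = subst (p + m ≤_) (sym (length-factorAt i n)) fits
  a-at : ∀ {k} → k < n → z (i + k) ≡ a → at (factorAt i n) k ≢ just b
  a-at k<n za isb =
    a≢b (just-injective (trans (cong just (sym za)) (trans (sym (at-applyUpTo _ n k<n)) isb)))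
  left : ∀ q → suc q ≡ p → at (factorAt i n) q ≢ just b
  left q q+1≡p = a-at (subst (_≤ n) (sym q+1≡p) (≤-trans (m≤m+n p m) fits)) (before q q+1≡p)
  right : at (factorAt i n) (p + m) ≢ just b
  right with m≤n⇒m<n∨m≡n fits
  ... | inj₁ end<n = a-at end<n (after end<n)
  ... | inj₂ end≡n = at-beyond (factorAt i n) (≤-reflexive (trans (length-factorAt i n) (sym end≡n)))

FRel-lower : ∀ j {n} → 2 ^ (suc j + 1) + suc j ∸ 2 ≤ n → ℓ (suc j) + j ≤ n
FRel-lower j {n} lo = subst (_≤ n) (cong (_∸ 1) (+-suc (ℓ (suc j)) j))
  (subst (λ t → t + suc j ∸ 2 ≤ n) (2^[k+1]≡1+ℓk (suc j)) lo)

FRel-upper : ∀ j {n} → n ≤ 2 ^ (j + 2) + j ∸ 2 → n ≤ ℓ j + ℓ j + j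
FRel-upper j {n} hi =
  subst (λ t → n ≤ t + j ∸ 2) (trans (cong (2 ^_) (+-suc j 1)) (2^[k+1]≡1+ℓk (suc j))) hi

factor-contains-long-run : ∀ n j → FRel n j → ∀ w → IsFactor w → length w ≡ n →
                           j ≡ 0 ⊎ ∃ λ p → ∃ λ m → BRun w p m × j ≤ m
factor-contains-long-run n zero    _        _ _        _    = inj₁ refl
factor-contains-long-run n (suc j) (lo , _) w (i , eq) refl
  with BBlock-in-window j (i + (ℓ (suc j) + j)) i (<⇒≤ (n<ℓn _))
... | d , d+m≤W , bb = inj₂ (BSegment⇒BRun w z<s fits (BBlock⇒BSegment i eq fits bb))
  where
  fits : d + suc j ≤ length w
  fits = ≤-trans d+m≤W (FRel-lower j lo)

factor-with-longest-run : ∀ n j → FRel n j → ∃ λ w → IsFactor w × length w ≡ n × LongestBRun w j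
factor-with-longest-run n j (lo , hi) =
  factorAt i₀ n , factorAt-IsFactor i₀ n , length-factorAt i₀ n , longest , attained
  where
  i₀ = ℓ (suc j) ∸ j
  i₀+j≡ℓ : i₀ + j ≡ ℓ (suc j)
  i₀+j≡ℓ = m∸n+n≡m (≤-trans (n≤1+n j) (<⇒≤ (n<ℓn (suc j))))
  swap : ∀ i x j → i + (x + j) ≡ i + j + x
  swap = solve-∀
  end< : i₀ + n < ℓ (suc j) + ℓ (suc j)
  end< = begin-strict
    i₀ + n                  ≤⟨ +-monoʳ-≤ i₀ (FRel-upper j hi) ⟩
    i₀ + (ℓ j + ℓ j + j)    ≡⟨ swap i₀ (ℓ j + ℓ j) j ⟩
    i₀ + j + (ℓ j + ℓ j)    ≡⟨ cong (_+ (ℓ j + ℓ j)) i₀+j≡ℓ ⟩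
    ℓ (suc j) + (ℓ j + ℓ j) <⟨ +-monoʳ-< (ℓ (suc j)) (n<1+n (ℓ j + ℓ j)) ⟩
    ℓ (suc j) + ℓ (suc j)   ∎
    where open ≤-Reasoning
  no-long-block : ∀ {X} → i₀ ≤ X → X + suc j < ℓ (suc j) + ℓ (suc j) → ¬ BBlock X (suc j)
  no-long-block {X} i₀≤X end<′ bb with window (suc j) X (suc j) (<⇒≤ end<′)
  ... | inFirst first =
    <⇒≱ (+-mono-≤-< i₀≤X (n<1+n j)) (subst (X + suc j ≤_) (sym i₀+j≡ℓ) first)
  ... | inSecond {X′} second =
    no-long-BBlock j (≤-pred (+-cancelˡ-< (ℓ (suc j)) _ _
      (subst (_< ℓ (suc j) + ℓ (suc j)) (+-assoc (ℓ (suc j)) X′ (suc j)) end<′)))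
      (BBlock-unshift (suc j) {X′} second bb)
  ... | acrossℓ X<ℓ ℓ<end = BBlock-∌a bb (z-ℓ (suc j)) (<⇒≤ X<ℓ) ℓ<end
  longest : ∀ p m → BRun (factorAt i₀ n) p m → m ≤ j
  longest p m run@(_ , p+m≤|w| , _) = ≮⇒≥ λ j<m →
    no-long-block (m≤m+n i₀ p)
      (≤-<-trans (+-offset-≤ i₀ (≤-trans (+-monoʳ-≤ p j<m)
                   (subst (p + m ≤_) (length-factorAt i₀ n) p+m≤|w|))) end<)
      (BBlock-≤ {i₀ + p} j<m (BRun⇒BBlock i₀ (factorAt-self i₀ n) run))
  j≤n : j ≤ n
  j≤n = ≤-trans (∸-monoˡ-≤ 1 (+-monoˡ-≤ j (ℓ-pos j)))
                (subst (λ t → t + j ∸ 2 ≤ n) (2^[k+1]≡1+ℓk j) lo)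
  attained : j ≡ 0 ⊎ ∃ λ p → BRun (factorAt i₀ n) p j
  attained with j ≟ 0
  ... | yes j≡0 = inj₁ j≡0
  ... | no j≢0  = inj₂ (0 , BBlock⇒BRun i₀ (n≢0⇒n>0 j≢0) j≤n
          (subst (λ x → BBlock x j) (sym (+-identityʳ i₀)) (BBlock-suffix (suc j) {i₀} (n≤1+n j) i₀+j≡ℓ))
          (λ _ ()) (λ _ → trans (cong z i₀+j≡ℓ) (z-ℓ (suc j))))

short-factor-with-two-runs : ∀ n → 1 ≤ n →
  ∃ λ w → IsFactor w × length w ≡ 2 ^ (n + 1) + n ∸ 1 × TwoBRuns w n
short-factor-with-two-runs (suc n) _ with m≤n⇒∃[o]m+o≡n (n<ℓn (suc n))
... | o , m+1+o≡ℓ =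
  factorAt i₀ (ℓ m + m) , factorAt-IsFactor i₀ _ , len , 0 , ℓ m , ℓ-pos m , first-run , second-run
  where
  m = suc n
  o+m+1≡ℓ : o + suc m ≡ ℓ m
  o+m+1≡ℓ = trans (+-comm o (suc m)) m+1+o≡ℓ
  i₀ = suc o
  i₀+m≡ℓ : i₀ + m ≡ ℓ m
  i₀+m≡ℓ = trans (sym (+-suc o m)) o+m+1≡ℓ
  bb : BBlock i₀ m
  bb = BBlock-suffix m {i₀} ≤-refl i₀+m≡ℓ
  len : length (factorAt i₀ (ℓ m + m)) ≡ 2 ^ (m + 1) + m ∸ 1
  len = trans (length-factorAt i₀ (ℓ m + m)) (cong (λ t → t + m ∸ 1) (sym (2^[k+1]≡1+ℓk m)))
  before : ∀ q → suc q ≡ ℓ m → z (i₀ + q) ≡ a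
  before q q+1≡ℓ = begin
    z (suc o + q) ≡⟨ cong z (trans (sym (+-suc o q)) (trans (cong (o +_) q+1≡ℓ) (+-comm o (ℓ m)))) ⟩
    z (ℓ m + o)   ≡⟨ z-self-similar m (subst (o <_) o+m+1≡ℓ (m<m+n o z<s)) ⟩
    z o           ≡⟨ z-before-suffix m o+m+1≡ℓ ⟩
    a             ∎
    where open ≡-Reasoning
  first-run : BRun (factorAt i₀ (ℓ m + m)) 0 m
  first-run = BBlock⇒BRun i₀ z<s (m≤n+m m (ℓ m)) (subst (λ x → BBlock x m) (sym (+-identityʳ i₀)) bb)
                (λ _ ()) (λ _ → trans (cong z i₀+m≡ℓ) (z-ℓ m))
  second-run : BRun (factorAt i₀ (ℓ m + m)) (ℓ m) m
  second-run = BBlock⇒BRun i₀ z<s ≤-refl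
                 (subst (λ x → BBlock x m) (+-comm (ℓ m) i₀) (BBlock-shift m {i₀} (≤-reflexive i₀+m≡ℓ) bb))
                 before (λ end< → ⊥-elim (<-irrefl refl end<))

two-runs-length-bound : ∀ n → 1 ≤ n → ∀ w → IsFactor w → TwoBRuns w n → 2 ^ (n + 1) + n ∸ 1 ≤ length w
two-runs-length-bound (suc n) _ w (i , eq) (p , q , p<q , first , second@(_ , q+m≤|w| , _)) =
  subst (_≤ length w) (cong (λ t → t + suc n ∸ 1) (sym (2^[k+1]≡1+ℓk (suc n))))
    (≤-trans (+-monoˡ-≤ (suc n) ℓ≤q) q+m≤|w|)
  where
  gap : i + p + ℓ (suc n) ≤ i + q
  gap = BBlock-gap n (i + q + suc n) (<⇒≤ (n<ℓn _))
          (BRun⇒BBlock i eq first)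
          (BRun⇒a-after i eq first (<-≤-trans (+-monoˡ-< (suc n) p<q) q+m≤|w|))
          (BRun⇒BBlock i eq second) (+-monoʳ-< i p<q)
  ℓ≤q : ℓ (suc n) ≤ q
  ℓ≤q = ≤-trans (m≤n+m (ℓ (suc n)) p) (+-cancelˡ-≤ i _ _ (subst (_≤ i + q) (+-assoc i p _) gap))

corollary6 :
    (∀ n j → FRel n j →
      (∀ w → IsFactor w → length w ≡ n →
         j ≡ 0 ⊎ ∃ λ p → ∃ λ m → BRun w p m × j ≤ m)
      × (∃ λ w → IsFactor w × length w ≡ n × LongestBRun w j))
    × (∀ n → 1 ≤ n →
      (∃ λ w → IsFactor w × length w ≡ 2 ^ (n + 1) + n ∸ 1 × TwoBRuns w n)
      × (∀ w → IsFactor w → TwoBRuns w n → 2 ^ (n + 1) + n ∸ 1 ≤ length w))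
corollary6 =
  (λ n j f[n]≡j → factor-contains-long-run n j f[n]≡j , factor-with-longest-run n j f[n]≡j) ,
  (λ n 1≤n → short-factor-with-two-runs n 1≤n , two-runs-length-bound n 1≤n)
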